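{- Let $k\ge 5$ be an integer. Then \[\gamma^{SID}(C_{2k}(1,k))=\begin{cases}\left\lceil\frac{4k}{3}\right\rceil & \text{if } k\equiv 0,1\pmod 3,\\ \left\lceil\frac{4k}{3}\right\rceil+1 & \text{if } k\equiv 2\pmod 3.\end{cases}\]
   Context: All graphs are simple and undirected. For a graph $G=(V,E)$ and $u\in V$, $N[u]=\{u\}\cup\{v: uv\in E\}$. A code is a nonempty $C\subseteq V$, and $I(C;u)=N[u]\cap C$. $C$ is self-identifying if $I(C;u)\setminus I(C;v)\neq\emptyset$ for all distinct $u,v\in V$. $\gamma^{SID}(G)$ is the minimum cardinality of a self-identifying code in a finite graph $G$. The circulant graph $C_{2k}(1,k)$ has vertex set $\mathbb{Z}_{2k}$, and the open neighbourhood of $u$ is $\{u-1,u+1,u+k\}$ modulo $2k$ (note $u-k\equiv u+k$). -}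

module Defs where

open import Data.Nat using (ℕ; _+_; _*_; _≤_)
open import Data.Fin using (Fin; toℕ)
open import Data.Fin.Subset using (Subset; _∈_; Nonempty; ∣_∣)
open import Data.Product using (_×_; ∃)
open import Data.Sum using (_⊎_)
open import Relation.Nullary using (¬_)
open import Relation.Binary.PropositionalEquality using (_≡_; _≢_)

Adjacency : ℕ → Set₁
Adjacency n = Fin n → Fin n → Set

InN : ∀ {n} → Adjacency n → Fin n → Fin n → Set
InN Adj u v = (u ≡ v) ⊎ Adj u v

-- C is self-identifying: C nonempty, and for all distinct u, v,
-- I(C;u) \ I(C;v) ≠ ∅, i.e. some w ∈ C lies in N[u] but not in N[v].
SelfIdentifying : ∀ {n} → Adjacency n → Subset n → Set
SelfIdentifying {n} Adj C =
  Nonempty C ×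
  (∀ (u v : Fin n) → u ≢ v →
     ∃ λ (w : Fin n) → w ∈ C × InN Adj u w × ¬ InN Adj v w)

γSID≡ : ∀ {n} → Adjacency n → ℕ → Set
γSID≡ {n} Adj m =
  (∃ λ (C : Subset n) → SelfIdentifying Adj C × ∣ C ∣ ≡ m) ×
  (∀ (C : Subset n) → SelfIdentifying Adj C → m ≤ ∣ C ∣)

-- v ≡ u + d (mod n), for u v ∈ Z_n represented by 0..n-1 (and d < n):
-- u + d = v  or  u + d = v + n.
StepMod : (n d : ℕ) → Fin n → Fin n → Set
StepMod n d u v = (toℕ u + d ≡ toℕ v) ⊎ (toℕ u + d ≡ toℕ v + n)

-- The circulant graph C_{2k}(1,k) on Z_{2k}:
-- v is adjacent to u iff v ∈ {u+1, u-1, u+k} (mod 2k).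
Circulant1k : (k : ℕ) → Adjacency (2 * k)
Circulant1k k u v =
  StepMod (2 * k) 1 u v ⊎ StepMod (2 * k) 1 v u ⊎ StepMod (2 * k) k u v

-- Let t i ∈ {0,1,2} count the non-codewords on the rung {i, i + k}, so that |C| = 2k − Σ_{i<k} t i.
-- Comparing N[u] with N[v] for suitable nearby u ≠ v shows that a self-identifying code cannot miss
-- two vertices at cycle distance 1 or 2, nor both x + 1 and x + k. Hence consecutive rungs are never
-- both hit, and a rung with t = 2 has t = 0 two rungs away on either side. Summing a local slack over
-- the windows of three consecutive rungs gives Σ slack + 6 Σ t = 4k with Σ slack ≠ 2, so 3 Σ t ≤ 2k
-- and 3 Σ t + 1 ≠ 2k, i.e. Σ t ≤ 2⌊k/3⌋. Dropping the rungs with index ≡ 2 (mod 3) gives a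
-- self-identifying code attaining this bound, so γ^SID = 2k − 2⌊k/3⌋, which is the stated value.

module Submission where

open import Defs
open import Data.Nat using (ℕ; _+_; _*_; _/_; _%_; _≤_)
open import Relation.Binary.PropositionalEquality using (_≡_)
open import Data.Product using (_×_)

open import Data.Bool using (Bool; true; false; T; not; _∧_; if_then_else_)
open import Data.Bool.Properties using (T-∧)
open import Data.Empty using (⊥-elim)
open import Data.Fin using (Fin; toℕ)
import Data.Fin as Fin
open import Data.Fin.Properties using (toℕ-fromℕ<; toℕ-injective; toℕ<n)
import Data.Fin.Properties as Finₚ
open import Data.Fin.Subset using (Subset; _∈_; ∣_∣)
open import Data.Nat using (suc; zero; _∸_; _<_; _≡ᵇ_; _<ᵇ_; z≤n; s≤s; NonZero; >-nonZero)
open import Data.Nat.DivMod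
open import Data.Nat.Divisibility using (divides)
open import Data.Nat.Properties
open import Data.Nat.Tactic.RingSolver using (solve-∀)
open import Data.Product using (_,_; ∃)
open import Data.Sum using (_⊎_; inj₁; inj₂)
import Data.Sum as Sum
open import Data.Unit using (tt)
open import Data.Vec using (_∷_; []; lookup; tabulate)
open import Data.Vec.Properties using ([]=⇒lookup; lookup⇒[]=; lookup∘tabulate)
open import Function using (case_of_; _∘_)
open import Function.Bundles using (Equivalence)
open import Relation.Binary.PropositionalEquality
  using (_≢_; refl; sym; trans; cong; cong₂; subst; module ≡-Reasoning)
open import Relation.Nullary using (¬_; Dec; yes; no)
open import Relation.Nullary.Decidable using (_⊎-dec_)

-- Finite sums

∑< : ℕ → (ℕ → ℕ) → ℕ
∑< zero    f = 0
∑< (suc n) f = ∑< n f + f n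

syntax ∑< n (λ i → e) = ∑[ i < n ] e

∑-cong : ∀ n {f g : ℕ → ℕ} → (∀ i → i < n → f i ≡ g i) → ∑< n f ≡ ∑< n g
∑-cong zero    f≡g = refl
∑-cong (suc n) f≡g = cong₂ _+_ (∑-cong n (λ i i<n → f≡g i (m<n⇒m<1+n i<n))) (f≡g n ≤-refl)

∑-+ : ∀ n (f g : ℕ → ℕ) → ∑[ i < n ] (f i + g i) ≡ ∑< n f + ∑< n g
∑-+ zero    f g = refl
∑-+ (suc n) f g = trans (cong (_+ (f n + g n)) (∑-+ n f g)) (+-shuffle (∑< n f) (∑< n g) (f n) (g n))
  where
  +-shuffle : ∀ a b c d → a + b + (c + d) ≡ a + c + (b + d)
  +-shuffle = solve-∀

∑-*ˡ : ∀ n c (f : ℕ → ℕ) → ∑[ i < n ] (c * f i) ≡ c * ∑< n f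
∑-*ˡ zero    c f = sym (*-zeroʳ c)
∑-*ˡ (suc n) c f = trans (cong (_+ c * f n) (∑-*ˡ n c f)) (sym (*-distribˡ-+ c (∑< n f) (f n)))

∑-const : ∀ n c → ∑[ i < n ] c ≡ n * c
∑-const zero    c = refl
∑-const (suc n) c = trans (cong (_+ c) (∑-const n c)) (+-comm (n * c) c)

∑-split : ∀ m n (f : ℕ → ℕ) → ∑< (m + n) f ≡ ∑< m f + ∑[ i < n ] f (m + i)
∑-split m zero    f = trans (cong (λ l → ∑< l f) (+-identityʳ m)) (sym (+-identityʳ _))
∑-split m (suc n) f = begin
  ∑< (m + suc n) f                                 ≡⟨ cong (λ l → ∑< l f) (+-suc m n) ⟩
  ∑< (m + n) f + f (m + n)                         ≡⟨ cong (_+ f (m + n)) (∑-split m n f) ⟩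
  ∑< m f + ∑[ i < n ] f (m + i) + f (m + n)        ≡⟨ +-assoc (∑< m f) _ (f (m + n)) ⟩
  ∑< m f + (∑[ i < n ] f (m + i) + f (m + n))      ∎
  where open ≡-Reasoning

∑-rotate : ∀ n (f : ℕ → ℕ) → f n ≡ f 0 → ∑[ i < n ] f (suc i) ≡ ∑< n f
∑-rotate n f fn≡f0 = +-cancelʳ-≡ (f 0) _ _ (begin
  ∑[ i < n ] f (suc i) + f 0 ≡⟨ +-comm _ (f 0) ⟩
  f 0 + ∑[ i < n ] f (suc i) ≡⟨ ∑-split 1 n f ⟨
  ∑< (suc n) f               ≡⟨ cong (∑< n f +_) fn≡f0 ⟩
  ∑< n f + f 0               ∎)
  where open ≡-Reasoning

∑-periodic-shift : ∀ n (f : ℕ → ℕ) → (∀ i → f (i + n) ≡ f i) → ∀ j → ∑[ i < n ] f (j + i) ≡ ∑< n f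
∑-periodic-shift n f periodic zero    = refl
∑-periodic-shift n f periodic (suc j) = begin
  ∑[ i < n ] f (suc j + i)      ≡⟨ ∑-cong n (λ i _ → cong f (sym (+-suc j i))) ⟩
  ∑[ i < n ] f (j + suc i)      ≡⟨ ∑-rotate n (λ i → f (j + i)) wraps ⟩
  ∑[ i < n ] f (j + i)          ≡⟨ ∑-periodic-shift n f periodic j ⟩
  ∑< n f                        ∎
  where
  open ≡-Reasoning
  wraps : f (j + n) ≡ f (j + 0)
  wraps = trans (periodic j) (cong f (sym (+-identityʳ j)))

term≤∑ : ∀ n (f : ℕ → ℕ) {i} → i < n → f i ≤ ∑< n f
term≤∑ (suc n) f {i} i<1+n with m≤n⇒m<n∨m≡n (≤-pred i<1+n)
... | inj₁ i<n  = ≤-trans (term≤∑ n f i<n) (m≤m+n _ _)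
... | inj₂ refl = m≤n+m (f i) (∑< n f)

two-terms≤∑ : ∀ n (f : ℕ → ℕ) {i j} → i < j → j < n → f i + f j ≤ ∑< n f
two-terms≤∑ (suc n) f {i} {j} i<j j<1+n with m≤n⇒m<n∨m≡n (≤-pred j<1+n)
... | inj₁ j<n  = ≤-trans (two-terms≤∑ n f i<j j<n) (m≤m+n _ _)
... | inj₂ refl = +-monoˡ-≤ (f j) (term≤∑ j f i<j)

∑-pos⇒term-pos : ∀ n (f : ℕ → ℕ) → 0 < ∑< n f → ∃ λ i → i < n × 0 < f i
∑-pos⇒term-pos (suc n) f 0<∑ with f n in fn≡
... | suc _ = n , ≤-refl , subst (0 <_) (sym fn≡) (s≤s z≤n)
... | zero with ∑-pos⇒term-pos n f (subst (0 <_) (+-identityʳ _) 0<∑)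
...   | i , i<n , 0<fi = i , m<n⇒m<1+n i<n , 0<fi

∑-double : ∀ k (f : ℕ → ℕ) → ∑< (2 * k) f ≡ ∑[ i < k ] (f i + f (i + k))
∑-double k f = begin
  ∑< (k + (k + 0)) f                 ≡⟨ cong (λ m → ∑< (k + m) f) (+-identityʳ k) ⟩
  ∑< (k + k) f                       ≡⟨ ∑-split k k f ⟩
  ∑< k f + ∑[ i < k ] f (k + i)      ≡⟨ cong (∑< k f +_) (∑-cong k (λ i _ → cong f (+-comm k i))) ⟩
  ∑< k f + ∑[ i < k ] f (i + k)      ≡⟨ ∑-+ k f (λ i → f (i + k)) ⟨
  ∑[ i < k ] (f i + f (i + k))       ∎
  where open ≡-Reasoning

-- Arithmetic

+-swapʳ : ∀ x y z → x + y + z ≡ x + z + y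
+-swapʳ = solve-∀

*-distribʳ-+-assoc : ∀ x p q N → x + (p + q) * N ≡ x + p * N + q * N
*-distribʳ-+-assoc = solve-∀

+-suc-assoc : ∀ a s t → a + (s + t) + 1 ≡ a + (suc s + t)
+-suc-assoc = solve-∀

+-*-suc-assoc : ∀ a s b k → a + (s + b * k) + k ≡ a + (s + suc b * k)
+-*-suc-assoc = solve-∀

*-double-fold : ∀ s b p k → s + b * k + p * (2 * k) ≡ s + (b + p * 2) * k
*-double-fold = solve-∀

+-*-unique : ∀ {k} .{{_ : NonZero k}} {x y B B′} → x < k → y < k →
             x + B * k ≡ y + B′ * k → x ≡ y × B ≡ B′
+-*-unique {k} {x} {y} {B} {B′} x<k y<k eq = x≡y , *-cancelʳ-≡ B B′ k (+-cancelˡ-≡ y _ _ eq′)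
  where
  x≡y : x ≡ y
  x≡y = begin
    x                 ≡⟨ m<n⇒m%n≡m x<k ⟨
    x % k             ≡⟨ [m+kn]%n≡m%n x B k ⟨
    (x + B * k) % k   ≡⟨ cong (_% k) eq ⟩
    (y + B′ * k) % k  ≡⟨ [m+kn]%n≡m%n y B′ k ⟩
    y % k             ≡⟨ m<n⇒m%n≡m y<k ⟩
    y                 ∎
    where open ≡-Reasoning
  eq′ : y + B * k ≡ y + B′ * k
  eq′ = trans (cong (λ z → z + B * k) (sym x≡y)) eq

[1+m]%n≡[1+m%n]%n : ∀ m n .{{_ : NonZero n}} → suc m % n ≡ suc (m % n) % n
[1+m]%n≡[1+m%n]%n m n =
  trans (cong (λ x → suc x % n) (m≡m%n+[m/n]*n m n)) ([m+kn]%n≡m%n (suc (m % n)) (m / n) n)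

%-suc : ∀ m n .{{_ : NonZero n}} → suc m % n ≡ 0 ⊎ suc m % n ≡ suc (m % n)
%-suc m n with m≤n⇒m<n∨m≡n (m%n<n m n)
... | inj₁ 1+r<n = inj₂ (trans ([1+m]%n≡[1+m%n]%n m n) (m<n⇒m%n≡m 1+r<n))
... | inj₂ 1+r≡n = inj₁ (trans ([1+m]%n≡[1+m%n]%n m n) (trans (cong (_% n) 1+r≡n) (n%n≡0 n)))

3m≤2K⇒m≤2⌊K/3⌋ : ∀ K m → 3 * m ≤ 2 * K → 3 * m + 1 ≢ 2 * K → m ≤ 2 * (K / 3)
3m≤2K⇒m≤2⌊K/3⌋ K m 3m≤2K 3m+1≢2K = by-residue (K % 3) (m%n<n K 3) (m≡m%n+[m/n]*n K 3)
  where
  q : ℕ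
  q = K / 3

  ≤-from-thirds : ∀ j → 3 * m ≤ 3 * j + 2 → m ≤ j
  ≤-from-thirds j 3m≤ = ≤-pred (*-cancelˡ-< 3 m (suc j) (≤-<-trans 3m≤ (≤-reflexive (expand j))))
    where
    expand : ∀ j → suc (3 * j + 2) ≡ 3 * suc j
    expand = solve-∀

  twice : ∀ r → K ≡ r + q * 3 → 2 * K ≡ 3 * (2 * q) + 2 * r
  twice r K≡ = trans (cong (2 *_) K≡) (expand r q)
    where
    expand : ∀ r q → 2 * (r + q * 3) ≡ 3 * (2 * q) + 2 * r
    expand = solve-∀

  twice′ : K ≡ 2 + q * 3 → 2 * K ≡ 3 * (1 + 2 * q) + 1
  twice′ K≡ = trans (twice 2 K≡) (shift q)
    where
    shift : ∀ q → 3 * (2 * q) + 4 ≡ 3 * (1 + 2 * q) + 1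
    shift = solve-∀

  by-residue : ∀ r → r < 3 → K ≡ r + q * 3 → m ≤ 2 * q
  by-residue 0 _ K≡ = ≤-from-thirds (2 * q)
    (≤-trans 3m≤2K (≤-trans (≤-reflexive (trans (twice 0 K≡) (+-identityʳ _))) (m≤m+n _ 2)))
  by-residue 1 _ K≡ = ≤-from-thirds (2 * q) (≤-trans 3m≤2K (≤-reflexive (twice 1 K≡)))
  by-residue 2 _ K≡ with m≤n⇒m<n∨m≡n (≤-from-thirds (1 + 2 * q)
    (≤-trans 3m≤2K (≤-trans (≤-reflexive (twice′ K≡)) (+-monoʳ-≤ (3 * (1 + 2 * q)) (s≤s z≤n)))))
  ... | inj₁ m<1+2q = ≤-pred m<1+2q
  ... | inj₂ m≡1+2q = ⊥-elim (3m+1≢2K (trans (cong (λ x → 3 * x + 1) m≡1+2q) (sym (twice′ K≡))))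
  by-residue (suc (suc (suc _))) (s≤s (s≤s (s≤s ()))) _

isTwo : ℕ → ℕ
isTwo 2 = 1
isTwo _ = 0

∑-isTwo : ∀ q r → r < 3 → ∑[ i < q * 3 + r ] isTwo (i % 3) ≡ q
∑-isTwo zero    0 _ = refl
∑-isTwo zero    1 _ = refl
∑-isTwo zero    2 _ = refl
∑-isTwo zero    (suc (suc (suc _))) (s≤s (s≤s (s≤s ())))
∑-isTwo (suc q) r r<3 = begin
  ∑< (3 + (q * 3 + r)) f                     ≡⟨ ∑-split 3 (q * 3 + r) f ⟩
  1 + ∑[ i < q * 3 + r ] f (3 + i)           ≡⟨ cong suc (∑-cong (q * 3 + r) (λ i _ → cong isTwo (shift i))) ⟩
  1 + ∑< (q * 3 + r) f                       ≡⟨ cong suc (∑-isTwo q r r<3) ⟩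
  suc q                                      ∎
  where
  open ≡-Reasoning
  f : ℕ → ℕ
  f i = isTwo (i % 3)
  shift : ∀ i → (3 + i) % 3 ≡ i % 3
  shift i = trans (cong (_% 3) (+-comm 3 i)) ([m+n]%n≡m%n i 3)

T-∧⁻ : ∀ {x y} → T (x ∧ y) → T x × T y
T-∧⁻ = Equivalence.to T-∧

T-not⇒¬T : ∀ {x} → T (not x) → ¬ T x
T-not⇒¬T {true}  ()
T-not⇒¬T {false} _ ()

resolveʳ : ∀ {a b} {A : Set a} {B : Set b} → A ⊎ B → ¬ A → B
resolveʳ (inj₁ x) ¬x = ⊥-elim (¬x x)
resolveʳ (inj₂ y) _  = y

resolveˡ : ∀ {a b} {A : Set a} {B : Set b} → A ⊎ B → ¬ B → A
resolveˡ (inj₁ x) _  = x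
resolveˡ (inj₂ y) ¬y = ⊥-elim (¬y y)

grid : ∀ {a} {A A′ B B′ : Set a} → A ⊎ B → A′ ⊎ B′ → B ⊎ A′ → A ⊎ B′ → (A × A′) ⊎ (B × B′)
grid (inj₁ x) (inj₁ x′) _         _         = inj₁ (x , x′)
grid (inj₁ x) (inj₂ y′) (inj₁ y)  _         = inj₂ (y , y′)
grid (inj₁ x) (inj₂ y′) (inj₂ x′) _         = inj₁ (x , x′)
grid (inj₂ y) (inj₂ y′) _         _         = inj₂ (y , y′)
grid (inj₂ y) (inj₁ x′) _         (inj₁ x)  = inj₁ (x , x′)
grid (inj₂ y) (inj₁ x′) _         (inj₂ y′) = inj₂ (y , y′)

-- Discharging on cyclic sequences

data Window : ℕ → ℕ → ℕ → Set where
  w000 : Window 0 0 0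
  w001 : Window 0 0 1
  w002 : Window 0 0 2
  w100 : Window 1 0 0
  w101 : Window 1 0 1
  w200 : Window 2 0 0
  w010 : Window 0 1 0
  w020 : Window 0 2 0

window-centre : ∀ {b} → b ≤ 2 → Window 0 b 0
window-centre {0} _ = w000
window-centre {1} _ = w010
window-centre {2} _ = w020
window-centre {suc (suc (suc _))} (s≤s (s≤s ()))

window-sides : ∀ {a c} → a ≤ 2 → c ≤ 2 → (a ≡ 2 → c ≡ 0) → (c ≡ 2 → a ≡ 0) → Window a 0 c
window-sides {0} {0} _ _ _ _ = w000
window-sides {0} {1} _ _ _ _ = w001
window-sides {0} {2} _ _ _ _ = w002
window-sides {1} {0} _ _ _ _ = w100
window-sides {1} {1} _ _ _ _ = w101
window-sides {2} {0} _ _ _ _ = w200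
window-sides {1} {2} _ _ _ 2→0ʳ = case 2→0ʳ refl of λ ()
window-sides {2} {1} _ _ 2→0ˡ _ = case 2→0ˡ refl of λ ()
window-sides {2} {2} _ _ 2→0ˡ _ = case 2→0ˡ refl of λ ()
window-sides {suc (suc (suc _))} (s≤s (s≤s ())) _ _ _
window-sides {_} {suc (suc (suc _))} _ (s≤s (s≤s ())) _ _

window : ∀ {a b c} → a ≤ 2 → b ≤ 2 → c ≤ 2 → a ≡ 0 ⊎ b ≡ 0 → b ≡ 0 ⊎ c ≡ 0 →
         (a ≡ 2 → c ≡ 0) → (c ≡ 2 → a ≡ 0) → Window a b c
window _   b≤2 _   (inj₁ refl) (inj₂ refl) _    _    = window-centre b≤2
window a≤2 _   c≤2 (inj₂ refl) _           2→0ˡ 2→0ʳ = window-sides a≤2 c≤2 2→0ˡ 2→0ʳ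
window a≤2 _   c≤2 (inj₁ refl) (inj₁ refl) 2→0ˡ 2→0ʳ = window-sides a≤2 c≤2 2→0ˡ 2→0ʳ

isOne : ℕ → ℕ
isOne 1 = 1
isOne _ = 0

-- The slack is whatever makes slack-balance hold; the isOne corrections telescope
-- when the identity is summed round the cycle.
slack : ∀ {a b c} → Window a b c → ℕ
slack w000 = 4
slack w001 = 3
slack w100 = 3
slack w101 = 2
slack w002 = 0
slack w200 = 0
slack w010 = 0
slack w020 = 0

slack-balance : ∀ {a b c} (w : Window a b c) →
                slack w + 2 * (a + b + c) + 2 * isOne b ≡ 4 + isOne a + isOne c
slack-balance w000 = refl
slack-balance w001 = refl
slack-balance w002 = refl
slack-balance w100 = refl
slack-balance w101 = refl
slack-balance w200 = refl
slack-balance w010 = refl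
slack-balance w020 = refl

slack≤2⇒w101 : ∀ {a b c} (w : Window a b c) → 0 < slack w → slack w ≤ 2 → a ≡ 1 × c ≡ 1
slack≤2⇒w101 w101 _ _ = refl , refl
slack≤2⇒w101 w000 _ (s≤s (s≤s ()))
slack≤2⇒w101 w001 _ (s≤s (s≤s ()))
slack≤2⇒w101 w100 _ (s≤s (s≤s ()))

slack-leading-1 : ∀ {a b c} (w : Window a b c) → a ≡ 1 → 2 ≤ slack w
slack-leading-1 w100 _ = s≤s (s≤s z≤n)
slack-leading-1 w101 _ = s≤s (s≤s z≤n)

slack-cong : ∀ {a b c a′ b′ c′} → a ≡ a′ → b ≡ b′ → c ≡ c′ →
             (w : Window a b c) (w′ : Window a′ b′ c′) → slack w ≡ slack w′
slack-cong refl refl refl w000 w000 = refl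
slack-cong refl refl refl w001 w001 = refl
slack-cong refl refl refl w002 w002 = refl
slack-cong refl refl refl w100 w100 = refl
slack-cong refl refl refl w101 w101 = refl
slack-cong refl refl refl w200 w200 = refl
slack-cong refl refl refl w010 w010 = refl
slack-cong refl refl refl w020 w020 = refl

module Discharging (K : ℕ) (t : ℕ → ℕ) (periodic : ∀ i → t (i + K) ≡ t i)
                   (window-at : ∀ i → Window (t i) (t (1 + i)) (t (2 + i))) where

  slackAt : ℕ → ℕ
  slackAt i = slack (window-at i)

  ∑t ∑ones ∑slack : ℕ
  ∑t     = ∑< K t
  ∑ones  = ∑[ i < K ] isOne (t i)
  ∑slack = ∑< K slackAt

  private
    ∑t-shift : ∀ j → ∑[ i < K ] t (j + i) ≡ ∑t
    ∑t-shift = ∑-periodic-shift K t periodic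

    ∑isOne-shift : ∀ j → ∑[ i < K ] isOne (t (j + i)) ≡ ∑ones
    ∑isOne-shift = ∑-periodic-shift K (λ i → isOne (t i)) (λ i → cong isOne (periodic i))

    slackAt-periodic : ∀ i → slackAt (i + K) ≡ slackAt i
    slackAt-periodic i =
      slack-cong (periodic i) (periodic (1 + i)) (periodic (2 + i)) (window-at (i + K)) (window-at i)

  ∑-window : ∑[ i < K ] (t i + t (1 + i) + t (2 + i)) ≡ 3 * ∑t
  ∑-window = begin
    ∑[ i < K ] (t i + t (1 + i) + t (2 + i))             ≡⟨ ∑-+ K _ _ ⟩
    ∑[ i < K ] (t i + t (1 + i)) + ∑[ i < K ] t (2 + i)  ≡⟨ cong₂ _+_ (∑-+ K t _) (∑t-shift 2) ⟩
    ∑t + ∑[ i < K ] t (1 + i) + ∑t                       ≡⟨ cong (λ x → ∑t + x + ∑t) (∑t-shift 1) ⟩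
    ∑t + ∑t + ∑t                                         ≡⟨ triple ∑t ⟩
    3 * ∑t                                               ∎
    where
    open ≡-Reasoning
    triple : ∀ x → x + x + x ≡ 3 * x
    triple = solve-∀

  ∑slack+6∑t≡4K : ∑slack + 6 * ∑t ≡ 4 * K
  ∑slack+6∑t≡4K = +-cancelʳ-≡ (2 * ∑ones) _ _ (begin
    ∑slack + 6 * ∑t + 2 * ∑ones
      ≡⟨ cong (λ x → ∑slack + x + 2 * ∑ones) (*-assoc 2 3 ∑t) ⟩
    ∑slack + 2 * (3 * ∑t) + 2 * ∑ones
      ≡⟨ cong₂ (λ x y → ∑slack + 2 * x + 2 * y) (sym ∑-window) (sym (∑isOne-shift 1)) ⟩
    ∑slack + 2 * ∑[ i < K ] (t i + t (1 + i) + t (2 + i)) + 2 * ∑[ i < K ] isOne (t (1 + i))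
      ≡⟨ cong₂ (λ x y → ∑slack + x + y) (∑-*ˡ K 2 _) (∑-*ˡ K 2 _) ⟨
    ∑slack + ∑[ i < K ] (2 * (t i + t (1 + i) + t (2 + i))) + ∑[ i < K ] (2 * isOne (t (1 + i)))
      ≡⟨ cong (_+ _) (∑-+ K slackAt _) ⟨
    ∑[ i < K ] (slackAt i + 2 * (t i + t (1 + i) + t (2 + i))) + ∑[ i < K ] (2 * isOne (t (1 + i)))
      ≡⟨ ∑-+ K _ _ ⟨
    ∑[ i < K ] (slackAt i + 2 * (t i + t (1 + i) + t (2 + i)) + 2 * isOne (t (1 + i)))
      ≡⟨ ∑-cong K (λ i _ → slack-balance (window-at i)) ⟩
    ∑[ i < K ] (4 + isOne (t i) + isOne (t (2 + i)))
      ≡⟨ ∑-+ K _ _ ⟩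
    ∑[ i < K ] (4 + isOne (t i)) + ∑[ i < K ] isOne (t (2 + i))
      ≡⟨ cong₂ _+_ (∑-+ K _ _) (∑isOne-shift 2) ⟩
    ∑[ i < K ] 4 + ∑ones + ∑ones
      ≡⟨ cong (λ x → x + ∑ones + ∑ones) (∑-const K 4) ⟩
    K * 4 + ∑ones + ∑ones
      ≡⟨ rearrange K ∑ones ⟩
    4 * K + 2 * ∑ones ∎)
    where
    open ≡-Reasoning
    rearrange : ∀ k o → k * 4 + o + o ≡ 4 * k + 2 * o
    rearrange = solve-∀

  -- A slack of 2 only comes from the window 1 0 1, whose right-hand 1 starts another
  -- window of slack at least 2.
  ∑slack≢2 : 2 < K → ∑slack ≢ 2
  ∑slack≢2 2<K ∑slack≡2 with ∑-pos⇒term-pos K slackAt (subst (0 <_) (sym ∑slack≡2) (s≤s z≤n))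
  ... | i , i<K , 0<slack
    with slack≤2⇒w101 (window-at i) 0<slack (subst (slackAt i ≤_) ∑slack≡2 (term≤∑ K slackAt i<K))
  ... | ti≡1 , t2+i≡1 = <⇒≱ (s≤s (s≤s (s≤s z≤n))) (begin
    4                                  ≤⟨ +-mono-≤ (slack-leading-1 (window-at i) ti≡1)
                                                   (slack-leading-1 (window-at (2 + i)) t2+i≡1) ⟩
    slackAt i + slackAt (2 + i)        ≡⟨ cong₂ _+_ (cong slackAt (+-identityʳ i)) (cong slackAt (+-comm i 2)) ⟨
    slackAt (i + 0) + slackAt (i + 2)  ≤⟨ two-terms≤∑ K (λ j → slackAt (i + j)) (s≤s z≤n) 2<K ⟩
    ∑[ j < K ] slackAt (i + j)         ≡⟨ ∑-periodic-shift K slackAt slackAt-periodic i ⟩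
    ∑slack                             ≡⟨ ∑slack≡2 ⟩
    2                                  ∎)
    where open ≤-Reasoning

  3∑≤2K : 3 * ∑t ≤ 2 * K
  3∑≤2K = *-cancelˡ-≤ 2 (begin
    2 * (3 * ∑t)      ≡⟨ *-assoc 2 3 ∑t ⟨
    6 * ∑t            ≤⟨ m≤n+m (6 * ∑t) ∑slack ⟩
    ∑slack + 6 * ∑t   ≡⟨ ∑slack+6∑t≡4K ⟩
    4 * K             ≡⟨ *-assoc 2 2 K ⟩
    2 * (2 * K)       ∎)
    where open ≤-Reasoning

  3∑+1≢2K : 2 < K → 3 * ∑t + 1 ≢ 2 * K
  3∑+1≢2K 2<K 3∑+1≡2K = ∑slack≢2 2<K (+-cancelʳ-≡ (6 * ∑t) ∑slack 2 (begin
    ∑slack + 6 * ∑t   ≡⟨ ∑slack+6∑t≡4K ⟩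
    4 * K             ≡⟨ *-assoc 2 2 K ⟩
    2 * (2 * K)       ≡⟨ cong (2 *_) 3∑+1≡2K ⟨
    2 * (3 * ∑t + 1)  ≡⟨ double ∑t ⟩
    2 + 6 * ∑t        ∎))
    where
    open ≡-Reasoning
    double : ∀ x → 2 * (3 * x + 1) ≡ 2 + 6 * x
    double = solve-∀

∣∣+∑missing≡size : ∀ {N} (C : Subset N) (f : ℕ → ℕ) →
                   (∀ v → f (toℕ v) ≡ (if lookup C v then 0 else 1)) → ∣ C ∣ + ∑< N f ≡ N
∣∣+∑missing≡size {zero}  []      f f≡ = refl
∣∣+∑missing≡size {suc N} (b ∷ C) f f≡ = begin
  ∣ b ∷ C ∣ + ∑< (suc N) f                  ≡⟨ cong (∣ b ∷ C ∣ +_) (∑-split 1 N f) ⟩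
  ∣ b ∷ C ∣ + (f 0 + ∑[ i < N ] f (suc i))   ≡⟨ cong (λ m → ∣ b ∷ C ∣ + (m + _)) (f≡ Fin.zero) ⟩
  ∣ b ∷ C ∣ + (χ b + ∑[ i < N ] f (suc i))   ≡⟨ head b ⟩
  suc (∣ C ∣ + ∑[ i < N ] f (suc i))         ≡⟨ cong suc (∣∣+∑missing≡size C (f ∘ suc) (f≡ ∘ Fin.suc)) ⟩
  suc N                                      ∎
  where
  open ≡-Reasoning
  χ : Bool → ℕ
  χ b = if b then 0 else 1
  head : ∀ b {m} → ∣ b ∷ C ∣ + (χ b + m) ≡ suc (∣ C ∣ + m)
  head true  = refl
  head false = +-suc ∣ C ∣ _

covered-by-two : ∀ {N} {Adj : Adjacency N} {C : Subset N} → SelfIdentifying Adj C →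
                 ∀ {u v m₁ m₂} → u ≢ v → (∀ w → InN Adj u w → InN Adj v w ⊎ w ≡ m₁ ⊎ w ≡ m₂) →
                 m₁ ∈ C ⊎ m₂ ∈ C
covered-by-two (_ , separates) {u} {v} u≢v cover with separates u v u≢v
... | w , w∈C , w∈N[u] , w∉N[v] with cover w w∈N[u]
...   | inj₁ w∈N[v]      = ⊥-elim (w∉N[v] w∈N[v])
...   | inj₂ (inj₁ refl) = inj₁ w∈C
...   | inj₂ (inj₂ refl) = inj₂ w∈C

-- C₂ₖ(1,k) is the Möbius ladder: the cycle on ℤ₂ₖ together with the rungs {x, x + k}.
module Ladder (k : ℕ) (4<k : 4 < k) where

  n : ℕ
  n = 2 * k

  instance
    k-nonZero : NonZero k
    k-nonZero = >-nonZero (<-trans (s≤s z≤n) 4<k)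
    n-nonZero : NonZero n
    n-nonZero = m*n≢0 2 k

  G : Adjacency n
  G = Circulant1k k

  1<n : 1 < n
  1<n = <-≤-trans (s≤s (s≤s z≤n)) (≤-trans (<⇒≤ 4<k) (m≤m+n k (k + 0)))

  k<n : k < n
  k<n = m<m+n k (<-trans (s≤s z≤n) (subst (4 <_) (sym (+-identityʳ k)) 4<k))

  2<k : 2 < k
  2<k = <-trans (s≤s (s≤s (s≤s z≤n))) (<-trans (s≤s (s≤s (s≤s (s≤s z≤n)))) 4<k)

  2≤n : 2 ≤ n
  2≤n = 1<n

  -- Congruence modulo n, with multiples of n added on both sides to avoid subtraction.
  infix 4 _≈_
  data _≈_ (x y : ℕ) : Set where
    ≈-by : ∀ p q → x + p * n ≡ y + q * n → x ≈ y

  ≡⇒≈ : ∀ {x y} → x ≡ y → x ≈ y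
  ≡⇒≈ x≡y = ≈-by 0 0 (cong (_+ 0) x≡y)

  ≈-sym : ∀ {x y} → x ≈ y → y ≈ x
  ≈-sym (≈-by p q eq) = ≈-by q p (sym eq)

  ≈-trans : ∀ {x y z} → x ≈ y → y ≈ z → x ≈ z
  ≈-trans {x} {y} {z} (≈-by p q eq₁) (≈-by r s eq₂) = ≈-by (p + r) (s + q) (begin
    x + (p + r) * n      ≡⟨ *-distribʳ-+-assoc x p r n ⟩
    x + p * n + r * n    ≡⟨ cong (_+ r * n) eq₁ ⟩
    y + q * n + r * n    ≡⟨ +-swapʳ y (q * n) (r * n) ⟩
    y + r * n + q * n    ≡⟨ cong (_+ q * n) eq₂ ⟩
    z + s * n + q * n    ≡⟨ *-distribʳ-+-assoc z s q n ⟨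
    z + (s + q) * n      ∎)
    where open ≡-Reasoning

  ≈-+ʳ : ∀ {x y} z → x ≈ y → x + z ≈ y + z
  ≈-+ʳ {x} {y} z (≈-by p q eq) = ≈-by p q (begin
    x + z + p * n   ≡⟨ +-swapʳ x z (p * n) ⟩
    x + p * n + z   ≡⟨ cong (_+ z) eq ⟩
    y + q * n + z   ≡⟨ +-swapʳ y (q * n) z ⟩
    y + z + q * n   ∎)
    where open ≡-Reasoning

  ≈-cancelʳ : ∀ {x y} z → x + z ≈ y + z → x ≈ y
  ≈-cancelʳ {x} {y} z (≈-by p q eq) = ≈-by p q (+-cancelʳ-≡ z _ _ (begin
    x + p * n + z   ≡⟨ +-swapʳ x (p * n) z ⟩
    x + z + p * n   ≡⟨ eq ⟩
    y + z + q * n   ≡⟨ +-swapʳ y z (q * n) ⟩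
    y + q * n + z   ∎))
    where open ≡-Reasoning

  ≈-cancelˡ : ∀ {x y} z → z + x ≈ z + y → x ≈ y
  ≈-cancelˡ {x} {y} z z+x≈z+y =
    ≈-cancelʳ z (≈-trans (≡⇒≈ (+-comm x z)) (≈-trans z+x≈z+y (≡⇒≈ (+-comm z y))))

  +n≈ : ∀ x → x + n ≈ x
  +n≈ x = ≈-by 0 1 (trans (+-identityʳ (x + n)) (cong (x +_) (sym (+-identityʳ n))))

  +k+k≈ : ∀ x → x + k + k ≈ x
  +k+k≈ x = ≈-trans (≡⇒≈ (trans (+-assoc x k k) (cong (λ m → x + (k + m)) (sym (+-identityʳ k))))) (+n≈ x)

  %≈ : ∀ x → x % n ≈ x
  %≈ x = ≈-by (x / n) 0 (sym (trans (+-identityʳ x) (m≡m%n+[m/n]*n x n)))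

  ≈⇒% : ∀ {x y} → x ≈ y → x % n ≡ y % n
  ≈⇒% {x} {y} (≈-by p q eq) = begin
    x % n             ≡⟨ [m+kn]%n≡m%n x p n ⟨
    (x + p * n) % n   ≡⟨ cong (_% n) eq ⟩
    (y + q * n) % n   ≡⟨ [m+kn]%n≡m%n y q n ⟩
    y % n             ∎
    where open ≡-Reasoning

  ⟦_⟧ : ℕ → Fin n
  ⟦ x ⟧ = x mod n

  toℕ⟦⟧≈ : ∀ x → toℕ ⟦ x ⟧ ≈ x
  toℕ⟦⟧≈ x = subst (_≈ x) (sym (toℕ-fromℕ< (m%n<n x n))) (%≈ x)

  ⟦toℕ⟧ : ∀ v → ⟦ toℕ v ⟧ ≡ v
  ⟦toℕ⟧ v = toℕ-injective (trans (toℕ-fromℕ< (m%n<n (toℕ v) n)) (m<n⇒m%n≡m (toℕ<n v)))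

  ⟦⟧-cong : ∀ {x y} → x ≈ y → ⟦ x ⟧ ≡ ⟦ y ⟧
  ⟦⟧-cong {x} {y} x≈y = toℕ-injective (begin
    toℕ ⟦ x ⟧   ≡⟨ toℕ-fromℕ< (m%n<n x n) ⟩
    x % n       ≡⟨ ≈⇒% x≈y ⟩
    y % n       ≡⟨ toℕ-fromℕ< (m%n<n y n) ⟨
    toℕ ⟦ y ⟧   ∎)
    where open ≡-Reasoning

  ⟦⟧-injective : ∀ {x y} → ⟦ x ⟧ ≡ ⟦ y ⟧ → x ≈ y
  ⟦⟧-injective {x} {y} eq =
    ≈-trans (≈-sym (toℕ⟦⟧≈ x)) (≈-trans (≡⇒≈ (cong toℕ eq)) (toℕ⟦⟧≈ y))

  toℕ≈⇒≡⟦⟧ : ∀ {v x} → toℕ v ≈ x → v ≡ ⟦ x ⟧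
  toℕ≈⇒≡⟦⟧ {v} toℕv≈x = trans (sym (⟦toℕ⟧ v)) (⟦⟧-cong toℕv≈x)

  toℕ≈⇒≡ : ∀ {v w} → toℕ v ≈ toℕ w → v ≡ w
  toℕ≈⇒≡ {v} {w} v≈w = trans (toℕ≈⇒≡⟦⟧ v≈w) (⟦toℕ⟧ w)

  StepMod⇒≈ : ∀ {d u v} → StepMod n d u v → toℕ u + d ≈ toℕ v
  StepMod⇒≈ (inj₁ eq) = ≡⇒≈ eq
  StepMod⇒≈ (inj₂ eq) = ≈-trans (≡⇒≈ eq) (+n≈ _)

  ≈⇒StepMod : ∀ {d u v} → d < n → toℕ u + d ≈ toℕ v → StepMod n d u v
  ≈⇒StepMod {d} {u} {v} d<n u+d≈v with toℕ u + d <? n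
  ... | yes u+d<n = inj₁ (begin
    toℕ u + d          ≡⟨ m<n⇒m%n≡m u+d<n ⟨
    (toℕ u + d) % n    ≡⟨ ≈⇒% u+d≈v ⟩
    toℕ v % n          ≡⟨ m<n⇒m%n≡m (toℕ<n v) ⟩
    toℕ v              ∎)
    where open ≡-Reasoning
  ... | no u+d≮n = inj₂ (begin
    toℕ u + d                ≡⟨ m∸n+n≡m n≤u+d ⟨
    toℕ u + d ∸ n + n        ≡⟨ cong (_+ n) (m<n⇒m%n≡m u+d∸n<n) ⟨
    (toℕ u + d ∸ n) % n + n  ≡⟨ cong (_+ n) (m≤n⇒[n∸m]%m≡n%m n≤u+d) ⟩
    (toℕ u + d) % n + n      ≡⟨ cong (_+ n) (≈⇒% u+d≈v) ⟩
    toℕ v % n + n            ≡⟨ cong (_+ n) (m<n⇒m%n≡m (toℕ<n v)) ⟩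
    toℕ v + n                ∎)
    where
    open ≡-Reasoning
    n≤u+d : n ≤ toℕ u + d
    n≤u+d = ≮⇒≥ u+d≮n
    u+d∸n<n : toℕ u + d ∸ n < n
    u+d∸n<n = +-cancelʳ-< _ _ n (subst (_< n + n) (sym (m∸n+n≡m n≤u+d)) (+-mono-< (toℕ<n u) d<n))

  StepMod-k-sym : ∀ {u v} → StepMod n k u v → StepMod n k v u
  StepMod-k-sym {u} {v} u+k≈v =
    ≈⇒StepMod k<n (≈-trans (≈-+ʳ k (≈-sym (StepMod⇒≈ {k} {u} {v} u+k≈v))) (+k+k≈ (toℕ u)))

  InN-sym : ∀ {u v} → InN G u v → InN G v u
  InN-sym (inj₁ u≡v)                = inj₁ (sym u≡v)
  InN-sym (inj₂ (inj₁ u+1≡v))       = inj₂ (inj₂ (inj₁ u+1≡v))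
  InN-sym (inj₂ (inj₂ (inj₁ v+1≡u))) = inj₂ (inj₁ v+1≡u)
  InN-sym (inj₂ (inj₂ (inj₂ u+k≡v))) = inj₂ (inj₂ (inj₂ (StepMod-k-sym u+k≡v)))

  <ᵇ5⇒<k : ∀ x → T (x <ᵇ 5) → x < k
  <ᵇ5⇒<k x x<5 = <-≤-trans (<ᵇ⇒< x 5 x<5) 4<k

  apart : ℕ → ℕ → ℕ → ℕ → Bool
  apart s b s′ b′ = (s <ᵇ 5) ∧ (s′ <ᵇ 5) ∧ not ((s ≡ᵇ s′) ∧ (b % 2 ≡ᵇ b′ % 2))

  module Around (a : ℕ) where

    V : ℕ → ℕ → Fin n
    V s b = ⟦ a + (s + b * k) ⟧

    V-parity : ∀ s b → V s (2 + b) ≡ V s b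
    V-parity s b = ⟦⟧-cong (≈-by 0 1 (two-turns a s b k))
      where
      two-turns : ∀ a s b k → a + (s + (2 + b) * k) + 0 * (2 * k) ≡ a + (s + b * k) + 1 * (2 * k)
      two-turns = solve-∀

    V-injective : ∀ {s b s′ b′} → s < k → s′ < k → V s b ≡ V s′ b′ → s ≡ s′ × b % 2 ≡ b′ % 2
    V-injective {s} {b} {s′} {b′} s<k s′<k V≡V′ with ≈-cancelˡ a (⟦⟧-injective V≡V′)
    ... | ≈-by p q eq with +-*-unique {B = b + p * 2} {B′ = b′ + q * 2} s<k s′<k
                             (trans (sym (*-double-fold s b p k)) (trans eq (*-double-fold s′ b′ q k)))
    ...   | s≡s′ , b+2p≡b′+2q = s≡s′ , (begin
      b % 2              ≡⟨ [m+kn]%n≡m%n b p 2 ⟨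
      (b + p * 2) % 2    ≡⟨ cong (_% 2) b+2p≡b′+2q ⟩
      (b′ + q * 2) % 2   ≡⟨ [m+kn]%n≡m%n b′ q 2 ⟩
      b′ % 2             ∎)
      where open ≡-Reasoning

    V-apart : ∀ s b s′ b′ → T (apart s b s′ b′) → V s b ≢ V s′ b′
    V-apart s b s′ b′ ok V≡V′ with T-∧⁻ {s <ᵇ 5} ok
    ... | s<5 , rest with T-∧⁻ {s′ <ᵇ 5} rest
    ...   | s′<5 , differ with V-injective {s} {b} {s′} {b′} (<ᵇ5⇒<k s s<5) (<ᵇ5⇒<k s′ s′<5) V≡V′
    ...     | s≡s′ , parity = T-not⇒¬T differ (Equivalence.from T-∧ (≡⇒≡ᵇ s s′ s≡s′ , ≡⇒≡ᵇ _ _ parity))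

    V-step : ∀ s b → toℕ (V s b) + 1 ≈ toℕ (V (suc s) b)
    V-step s b = ≈-trans (≈-+ʳ 1 (toℕ⟦⟧≈ _))
                   (≈-trans (≡⇒≈ (+-suc-assoc a s (b * k))) (≈-sym (toℕ⟦⟧≈ _)))

    V-opp-step : ∀ s b → toℕ (V s b) + k ≈ toℕ (V s (suc b))
    V-opp-step s b = ≈-trans (≈-+ʳ k (toℕ⟦⟧≈ _))
                       (≈-trans (≡⇒≈ (+-*-suc-assoc a s b k)) (≈-sym (toℕ⟦⟧≈ _)))

    -- N[V (suc s) b]; the centre has s ≥ 1 so that its predecessor is again some V s b.
    data Nbhd (s b : ℕ) (w : Fin n) : Set where
      self : w ≡ V (suc s) b       → Nbhd s b w
      next : w ≡ V (2 + s) b       → Nbhd s b w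
      prev : w ≡ V s b             → Nbhd s b w
      opp  : w ≡ V (suc s) (suc b) → Nbhd s b w

    nbhd⁻ : ∀ s b {w} → InN G (V (suc s) b) w → Nbhd s b w
    nbhd⁻ s b (inj₁ u≡w) = self (sym u≡w)
    nbhd⁻ s b {w} (inj₂ (inj₁ u+1≡w)) =
      next (toℕ≈⇒≡ (≈-trans (≈-sym (StepMod⇒≈ {1} {V (suc s) b} {w} u+1≡w)) (V-step (suc s) b)))
    nbhd⁻ s b {w} (inj₂ (inj₂ (inj₁ w+1≡u))) =
      prev (toℕ≈⇒≡ (≈-cancelʳ 1 (≈-trans (StepMod⇒≈ {1} {w} w+1≡u) (≈-sym (V-step s b)))))
    nbhd⁻ s b {w} (inj₂ (inj₂ (inj₂ u+k≡w))) =
      opp (toℕ≈⇒≡ (≈-trans (≈-sym (StepMod⇒≈ {k} {V (suc s) b} {w} u+k≡w)) (V-opp-step (suc s) b)))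

    nbhd⁺ : ∀ s b {w} → Nbhd s b w → InN G (V (suc s) b) w
    nbhd⁺ s b (self refl) = inj₁ refl
    nbhd⁺ s b (next refl) = inj₂ (inj₁ (≈⇒StepMod 1<n (V-step (suc s) b)))
    nbhd⁺ s b (prev refl) = inj₂ (inj₂ (inj₁ (≈⇒StepMod 1<n (V-step s b))))
    nbhd⁺ s b (opp refl)  = inj₂ (inj₂ (inj₂ (≈⇒StepMod k<n (V-opp-step (suc s) b))))

    ApartNbhd : ℕ → ℕ → ℕ → ℕ → Set
    ApartNbhd s b s′ b′ = T (apart (suc s) b s′ b′) × T (apart (2 + s) b s′ b′) ×
                          T (apart s b s′ b′) × T (apart (suc s) (suc b) s′ b′)

    ∉nbhd : ∀ s b s′ b′ → ApartNbhd s b s′ b′ → ¬ InN G (V s′ b′) (V (suc s) b)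
    ∉nbhd s b s′ b′ (ok-self , ok-next , ok-prev , ok-opp) adj with nbhd⁻ s b (InN-sym adj)
    ... | self eq = V-apart (suc s) b s′ b′ ok-self (sym eq)
    ... | next eq = V-apart (2 + s) b s′ b′ ok-next (sym eq)
    ... | prev eq = V-apart s b s′ b′ ok-prev (sym eq)
    ... | opp eq  = V-apart (suc s) (suc b) s′ b′ ok-opp (sym eq)

  missing : Subset n → ℕ → ℕ
  missing C x = if lookup C ⟦ x ⟧ then 0 else 1

  missing-≈ : ∀ C {x y} → x ≈ y → missing C x ≡ missing C y
  missing-≈ C x≈y = cong (λ v → if lookup C v then 0 else 1) (⟦⟧-cong x≈y)

  ∣∣+∑missing≡n : ∀ C → ∣ C ∣ + ∑< n (missing C) ≡ n
  ∣∣+∑missing≡n C =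
    ∣∣+∑missing≡size C (missing C) (λ v → cong (λ w → if lookup C w then 0 else 1) (⟦toℕ⟧ v))

  missing-spec : ∀ C x → (⟦ x ⟧ ∈ C × missing C x ≡ 0) ⊎ (¬ ⟦ x ⟧ ∈ C × missing C x ≡ 1)
  missing-spec C x with lookup C ⟦ x ⟧ in lookup≡
  ... | true  = inj₁ (lookup⇒[]= ⟦ x ⟧ C lookup≡ , refl)
  ... | false = inj₂ ((λ x∈C → case trans (sym ([]=⇒lookup x∈C)) lookup≡ of λ ()) , refl)

  -- n ∸ 2 stands for −2 modulo n.
  centred : ∀ x s b → Around.V (x + (n ∸ 2)) (2 + s) b ≡ ⟦ x + (s + b * k) ⟧
  centred x s b = ⟦⟧-cong (≈-trans (≡⇒≈ (begin
    x + (n ∸ 2) + (2 + s + b * k)      ≡⟨ regroup x (n ∸ 2) s (b * k) ⟩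
    x + (s + b * k) + (n ∸ 2 + 2)      ≡⟨ cong (x + (s + b * k) +_) (m∸n+n≡m 2≤n) ⟩
    x + (s + b * k) + n                ∎)) (+n≈ _))
    where
    open ≡-Reasoning
    regroup : ∀ x m s t → x + m + (2 + s + t) ≡ x + (s + t) + (m + 2)
    regroup = solve-∀

  module LowerBound {C : Subset n} (sid : SelfIdentifying G C) where

    In : ℕ → Set
    In x = ⟦ x ⟧ ∈ C

    module _ (x : ℕ) where
      open Around (x + (n ∸ 2))

      private
        either : ∀ s b s′ b′ {y y′} → x + (s + b * k) ≡ y → x + (s′ + b′ * k) ≡ y′ →
                 V (2 + s) b ∈ C ⊎ V (2 + s′) b′ ∈ C → In y ⊎ In y′
        either s b s′ b′ eq eq′ = Sum.map (subst (_∈ C) (at s b eq)) (subst (_∈ C) (at s′ b′ eq′))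
          where
          at : ∀ s b {y} → x + (s + b * k) ≡ y → V (2 + s) b ≡ ⟦ y ⟧
          at s b eq = trans (centred x s b) (cong ⟦_⟧ eq)

      adjacent-pair : In x ⊎ In (1 + x)
      adjacent-pair = either 0 0 1 0 (+-identityʳ x) (+-comm x 1)
        (covered-by-two sid (V-apart 2 0 1 1 tt) cover)
        where
        cover : ∀ w → InN G (V 2 0) w → InN G (V 1 1) w ⊎ w ≡ V 2 0 ⊎ w ≡ V 3 0
        cover w w∈N with nbhd⁻ 1 0 w∈N
        ... | self w≡ = inj₂ (inj₁ w≡)
        ... | next w≡ = inj₂ (inj₂ w≡)
        ... | prev w≡ = inj₁ (nbhd⁺ 0 1 (opp (trans w≡ (sym (V-parity 1 0)))))
        ... | opp w≡  = inj₁ (nbhd⁺ 0 1 (next w≡))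

      gap-pair : In x ⊎ In (2 + x)
      gap-pair = either 0 0 2 0 (+-identityʳ x) (+-comm x 2)
        (covered-by-two sid (V-apart 3 0 3 1 tt) cover)
        where
        cover : ∀ w → InN G (V 3 0) w → InN G (V 3 1) w ⊎ w ≡ V 2 0 ⊎ w ≡ V 4 0
        cover w w∈N with nbhd⁻ 2 0 w∈N
        ... | self w≡ = inj₁ (nbhd⁺ 2 1 (opp (trans w≡ (sym (V-parity 3 0)))))
        ... | next w≡ = inj₂ (inj₂ w≡)
        ... | prev w≡ = inj₂ (inj₁ w≡)
        ... | opp w≡  = inj₁ (nbhd⁺ 2 1 (self w≡))

      diagonal-pair : In (1 + x) ⊎ In (x + k)
      diagonal-pair = either 1 0 0 1 (+-comm x 1) (cong (x +_) (+-identityʳ k))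
        (covered-by-two sid (V-apart 2 0 1 0 tt) cover)
        where
        cover : ∀ w → InN G (V 2 0) w → InN G (V 1 0) w ⊎ w ≡ V 3 0 ⊎ w ≡ V 2 1
        cover w w∈N with nbhd⁻ 1 0 w∈N
        ... | self w≡ = inj₁ (nbhd⁺ 0 0 (next w≡))
        ... | next w≡ = inj₂ (inj₁ w≡)
        ... | prev w≡ = inj₁ (nbhd⁺ 0 0 (self w≡))
        ... | opp w≡  = inj₂ (inj₂ w≡)

    In-≈ : ∀ {x y} → x ≈ y → In x → In y
    In-≈ x≈y = subst (_∈ C) (⟦⟧-cong x≈y)

    t : ℕ → ℕ
    t i = missing C i + missing C (i + k)

    t-periodic : ∀ i → t (i + k) ≡ t i
    t-periodic i = trans (cong (missing C (i + k) +_) (missing-≈ C (+k+k≈ i)))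
                         (+-comm (missing C (i + k)) (missing C i))

    t≤2 : ∀ i → t i ≤ 2
    t≤2 i = +-mono-≤ (missing≤1 i) (missing≤1 (i + k))
      where
      missing≤1 : ∀ x → missing C x ≤ 1
      missing≤1 x with missing-spec C x
      ... | inj₁ (_ , m≡0) = subst (_≤ 1) (sym m≡0) z≤n
      ... | inj₂ (_ , m≡1) = subst (_≤ 1) (sym m≡1) ≤-refl

    t≡0 : ∀ {i} → In i × In (i + k) → t i ≡ 0
    t≡0 {i} (In-i , In-i+k) = cong₂ _+_ (in⇒0 i In-i) (in⇒0 (i + k) In-i+k)
      where
      in⇒0 : ∀ x → In x → missing C x ≡ 0
      in⇒0 x In-x with missing-spec C x
      ... | inj₁ (_ , m≡0)      = m≡0
      ... | inj₂ (¬In-x , _)    = ⊥-elim (¬In-x In-x)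

    t≡2⇒¬In : ∀ {i} → t i ≡ 2 → ¬ In i × ¬ In (i + k)
    t≡2⇒¬In {i} t≡2 with missing-spec C i | missing-spec C (i + k)
    ... | inj₂ (¬In-i , _) | inj₂ (¬In-i+k , _) = ¬In-i , ¬In-i+k
    ... | inj₁ (_ , m≡0)   | inj₁ (_ , m′≡0)    = case trans (sym t≡2) (cong₂ _+_ m≡0 m′≡0) of λ ()
    ... | inj₁ (_ , m≡0)   | inj₂ (_ , m′≡1)    = case trans (sym t≡2) (cong₂ _+_ m≡0 m′≡1) of λ ()
    ... | inj₂ (_ , m≡1)   | inj₁ (_ , m′≡0)    = case trans (sym t≡2) (cong₂ _+_ m≡1 m′≡0) of λ ()

    t-sparse : ∀ i → t i ≡ 0 ⊎ t (1 + i) ≡ 0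
    t-sparse i = Sum.map t≡0 t≡0 (grid (adjacent-pair i) (adjacent-pair (i + k)) (diagonal-pair i)
                                       (Sum.swap (Sum.map₂ (In-≈ (+k+k≈ i)) (diagonal-pair (i + k)))))

    t-two-isolatedʳ : ∀ i → t i ≡ 2 → t (2 + i) ≡ 0
    t-two-isolatedʳ i t≡2 with t≡2⇒¬In t≡2
    ... | ¬In-i , ¬In-i+k = t≡0 (resolveʳ (gap-pair i) ¬In-i , resolveʳ (gap-pair (i + k)) ¬In-i+k)

    t-two-isolatedˡ : ∀ i → t (2 + i) ≡ 2 → t i ≡ 0
    t-two-isolatedˡ i t≡2 with t≡2⇒¬In {2 + i} t≡2
    ... | ¬In-2+i , ¬In-2+i+k = t≡0 (resolveˡ (gap-pair i) ¬In-2+i , resolveˡ (gap-pair (i + k)) ¬In-2+i+k)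

    t-window : ∀ i → Window (t i) (t (1 + i)) (t (2 + i))
    t-window i = window (t≤2 i) (t≤2 (1 + i)) (t≤2 (2 + i)) (t-sparse i) (t-sparse (1 + i))
                        (t-two-isolatedʳ i) (t-two-isolatedˡ i)

    open Discharging k t t-periodic t-window using (∑t; 3∑≤2K; 3∑+1≢2K)

    ∣C∣+∑t≡2k : ∣ C ∣ + ∑t ≡ 2 * k
    ∣C∣+∑t≡2k = trans (cong (∣ C ∣ +_) (sym (∑-double k (missing C)))) (∣∣+∑missing≡n C)

    2k≤∣C∣+2⌊k/3⌋ : 2 * k ≤ ∣ C ∣ + 2 * (k / 3)
    2k≤∣C∣+2⌊k/3⌋ = begin
      2 * k               ≡⟨ ∣C∣+∑t≡2k ⟨
      ∣ C ∣ + ∑t          ≤⟨ +-monoʳ-≤ ∣ C ∣ (3m≤2K⇒m≤2⌊K/3⌋ k ∑t 3∑≤2K (3∑+1≢2K 2<k)) ⟩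
      ∣ C ∣ + 2 * (k / 3) ∎
      where open ≤-Reasoning

  colour : ℕ → ℕ
  colour x = x % k % 3

  colour-≈ : ∀ {x y} → x ≈ y → colour x ≡ colour y
  colour-≈ {x} {y} (≈-by p q eq) = cong (_% 3) (begin
    x % k                  ≡⟨ [m+kn]%n≡m%n x (p * 2) k ⟨
    (x + p * 2 * k) % k    ≡⟨ cong (λ m → (x + m) % k) (*-assoc p 2 k) ⟩
    (x + p * n) % k        ≡⟨ cong (_% k) eq ⟩
    (y + q * n) % k        ≡⟨ cong (λ m → (y + m) % k) (*-assoc q 2 k) ⟨
    (y + q * 2 * k) % k    ≡⟨ [m+kn]%n≡m%n y (q * 2) k ⟩
    y % k                  ∎)
    where open ≡-Reasoning

  colour-+* : ∀ x b → colour (x + b * k) ≡ colour x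
  colour-+* x b = cong (_% 3) ([m+kn]%n≡m%n x b k)

  colour-suc : ∀ x → colour (suc x) ≡ 0 ⊎ colour (suc x) ≡ suc (colour x)
  colour-suc x with %-suc x k
  ... | inj₁ r≡0   = inj₁ (cong (_% 3) r≡0)
  ... | inj₂ r≡1+r = Sum.map (trans (cong (_% 3) r≡1+r)) (trans (cong (_% 3) r≡1+r)) (%-suc (x % k) 3)

  colour≢1⇒colour-suc≢2 : ∀ x → colour x ≢ 1 → colour (suc x) ≢ 2
  colour≢1⇒colour-suc≢2 x c≢1 c′≡2 with colour-suc x
  ... | inj₁ c′≡0 = case trans (sym c′≡0) c′≡2 of λ ()
  ... | inj₂ c′≡1+c = c≢1 (suc-injective (trans (sym c′≡1+c) c′≡2))

  colour-suc≢0⇒colour≢2 : ∀ x → colour (suc x) ≢ 0 → colour x ≢ 2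
  colour-suc≢0⇒colour≢2 x c′≢0 c≡2 with colour-suc x
  ... | inj₁ c′≡0 = c′≢0 c′≡0
  ... | inj₂ c′≡1+c = <⇒≢ (m%n<n (suc x % k) 3) (trans c′≡1+c (cong suc c≡2))

  -- The rungs {x, x + k} with x ≡ 2 (mod 3), 0 ≤ x < k, are left out of the code.
  C₀ : Subset n
  C₀ = tabulate (λ v → isTwo (colour (toℕ v)) ≡ᵇ 0)

  lookup-C₀ : ∀ x → lookup C₀ ⟦ x ⟧ ≡ (isTwo (colour x) ≡ᵇ 0)
  lookup-C₀ x = trans (lookup∘tabulate _ ⟦ x ⟧) (cong (λ c → isTwo c ≡ᵇ 0) (colour-≈ (toℕ⟦⟧≈ x)))

  ⟦⟧∈C₀ : ∀ x → colour x ≢ 2 → ⟦ x ⟧ ∈ C₀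
  ⟦⟧∈C₀ x c≢2 = lookup⇒[]= ⟦ x ⟧ C₀ (trans (lookup-C₀ x) (not-two (colour x) c≢2))
    where
    not-two : ∀ c → c ≢ 2 → (isTwo c ≡ᵇ 0) ≡ true
    not-two 0                   _   = refl
    not-two 1                   _   = refl
    not-two 2                   2≢2 = ⊥-elim (2≢2 refl)
    not-two (suc (suc (suc _))) _   = refl

  missing-C₀ : ∀ x → missing C₀ x ≡ isTwo (colour x)
  missing-C₀ x = trans (cong (λ b → if b then 0 else 1) (lookup-C₀ x)) (indicator (colour x))
    where
    indicator : ∀ c → (if isTwo c ≡ᵇ 0 then 0 else 1) ≡ isTwo c
    indicator 0                   = refl
    indicator 1                   = refl
    indicator 2                   = refl
    indicator (suc (suc (suc _))) = refl

  missing-C₀-rung : ∀ i → i < k → missing C₀ i + missing C₀ (i + k) ≡ 2 * isTwo (i % 3)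
  missing-C₀-rung i i<k = begin
    missing C₀ i + missing C₀ (i + k)        ≡⟨ cong₂ _+_ (missing-C₀ i) (missing-C₀ (i + k)) ⟩
    isTwo (colour i) + isTwo (colour (i + k)) ≡⟨ cong (λ c → isTwo (colour i) + isTwo (c % 3)) ([m+n]%n≡m%n i k) ⟩
    isTwo (colour i) + isTwo (colour i)       ≡⟨ cong (λ c → isTwo (c % 3) + isTwo (c % 3)) (m<n⇒m%n≡m i<k) ⟩
    isTwo (i % 3) + isTwo (i % 3)             ≡⟨ cong (isTwo (i % 3) +_) (+-identityʳ (isTwo (i % 3))) ⟨
    2 * isTwo (i % 3)                         ∎
    where open ≡-Reasoning

  ∣C₀∣+2⌊k/3⌋≡2k : ∣ C₀ ∣ + 2 * (k / 3) ≡ 2 * k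
  ∣C₀∣+2⌊k/3⌋≡2k = trans (cong (∣ C₀ ∣ +_) (sym ∑missing≡)) (∣∣+∑missing≡n C₀)
    where
    open ≡-Reasoning
    k≡ : k ≡ k / 3 * 3 + k % 3
    k≡ = trans (m≡m%n+[m/n]*n k 3) (+-comm (k % 3) (k / 3 * 3))
    ∑missing≡ : ∑< n (missing C₀) ≡ 2 * (k / 3)
    ∑missing≡ = begin
      ∑< n (missing C₀)                                ≡⟨ ∑-double k (missing C₀) ⟩
      ∑[ i < k ] (missing C₀ i + missing C₀ (i + k))   ≡⟨ ∑-cong k missing-C₀-rung ⟩
      ∑[ i < k ] (2 * isTwo (i % 3))                   ≡⟨ ∑-*ˡ k 2 (λ i → isTwo (i % 3)) ⟩
      2 * ∑[ i < k ] isTwo (i % 3)                     ≡⟨ cong (λ m → 2 * ∑[ i < m ] isTwo (i % 3)) k≡ ⟩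
      2 * ∑[ i < k / 3 * 3 + k % 3 ] isTwo (i % 3)     ≡⟨ cong (2 *_) (∑-isTwo (k / 3) (k % 3) (m%n<n k 3)) ⟩
      2 * (k / 3)                                      ∎

  InN? : ∀ u v → Dec (InN G u v)
  InN? u v = (u Finₚ.≟ v) ⊎-dec StepMod? 1 u v ⊎-dec StepMod? 1 v u ⊎-dec StepMod? k u v
    where
    StepMod? : ∀ d u v → Dec (StepMod n d u v)
    StepMod? d u v = (toℕ u + d ≟ toℕ v) ⊎-dec (toℕ u + d ≟ toℕ v + n)

  Separates : Fin n → Fin n → Fin n → Set
  Separates u v w = w ∈ C₀ × InN G u w × ¬ InN G v w

  module Separation (x : Fin n) where
    open Around (toℕ x + (n ∸ 2))

    private
      c : ℕ
      c = colour (toℕ x)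

      centre≡x : V 2 0 ≡ x
      centre≡x = trans (centred (toℕ x) 0 0) (trans (cong ⟦_⟧ (+-identityʳ (toℕ x))) (⟦toℕ⟧ x))

      colour-V : ∀ s b → colour (toℕ x + (n ∸ 2) + s) ≢ 2 → V s b ∈ C₀
      colour-V s b c≢2 = ⟦⟧∈C₀ _ (λ c′≡2 → c≢2 (trans (sym (trans (cong colour (sym (+-assoc _ s (b * k))))
                                                           (colour-+* _ b))) c′≡2))

      colour-2 : colour (toℕ x + (n ∸ 2) + 2) ≡ c
      colour-2 = colour-≈ (≈-trans (≡⇒≈ (trans (+-assoc (toℕ x) (n ∸ 2) 2)
                                          (cong (toℕ x +_) (m∸n+n≡m 2≤n)))) (+n≈ (toℕ x)))

      self∈ : c ≢ 2 → V 2 0 ∈ C₀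
      self∈ c≢2 = colour-V 2 0 (λ eq → c≢2 (trans (sym colour-2) eq))

      opp∈ : c ≢ 2 → V 2 1 ∈ C₀
      opp∈ c≢2 = colour-V 2 1 (λ eq → c≢2 (trans (sym colour-2) eq))

      next∈ : c ≢ 1 → V 3 0 ∈ C₀
      next∈ c≢1 = colour-V 3 0 (λ eq → colour≢1⇒colour-suc≢2 _ (λ eq′ → c≢1 (trans (sym colour-2) eq′))
                                         (trans (cong colour (sym (+-suc _ 2))) eq))

      prev∈ : c ≢ 0 → V 1 0 ∈ C₀
      prev∈ c≢0 = colour-V 1 0 (colour-suc≢0⇒colour≢2 _ (λ eq → c≢0 (trans (sym colour-2)
                                                           (trans (cong colour (+-suc _ 1)) eq))))

      separate-opposite : ∃ (Separates (V 2 0) (V 2 1))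
      separate-opposite with c ≟ 1
      ... | yes c≡1 = V 1 0 , prev∈ (λ c≡0 → case trans (sym c≡0) c≡1 of λ ()) ,
                      nbhd⁺ 1 0 (prev refl) , ∉nbhd 0 0 2 1 (tt , tt , tt , tt)
      ... | no  c≢1 = V 3 0 , next∈ c≢1 , nbhd⁺ 1 0 (next refl) , ∉nbhd 2 0 2 1 (tt , tt , tt , tt)

      separate-coded : c ≢ 2 → ∀ y → V 2 0 ≢ y → ∃ (Separates (V 2 0) y)
      separate-coded c≢2 y centre≢y with InN? y (V 2 0)
      ... | no  y≁centre = V 2 0 , self∈ c≢2 , nbhd⁺ 1 0 (self refl) , y≁centre
      ... | yes y∼centre with nbhd⁻ 1 0 (InN-sym y∼centre)
      ...   | self refl = ⊥-elim (centre≢y refl)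
      ...   | next refl = V 2 1 , opp∈ c≢2 , nbhd⁺ 1 0 (opp refl) , ∉nbhd 1 1 3 0 (tt , tt , tt , tt)
      ...   | prev refl = V 2 1 , opp∈ c≢2 , nbhd⁺ 1 0 (opp refl) , ∉nbhd 1 1 1 0 (tt , tt , tt , tt)
      ...   | opp  refl = separate-opposite

      separate-uncoded : c ≢ 0 → c ≢ 1 → ∀ y → V 2 0 ≢ y → ∃ (Separates (V 2 0) y)
      separate-uncoded c≢0 c≢1 y centre≢y with InN? y (V 1 0)
      ... | no  y≁prev = V 1 0 , prev∈ c≢0 , nbhd⁺ 1 0 (prev refl) , y≁prev
      ... | yes y∼prev with nbhd⁻ 0 0 (InN-sym y∼prev)
      ...   | self refl = V 3 0 , next∈ c≢1 , nbhd⁺ 1 0 (next refl) , ∉nbhd 2 0 1 0 (tt , tt , tt , tt)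
      ...   | next refl = ⊥-elim (centre≢y refl)
      ...   | prev refl = V 3 0 , next∈ c≢1 , nbhd⁺ 1 0 (next refl) , ∉nbhd 2 0 0 0 (tt , tt , tt , tt)
      ...   | opp  refl = V 3 0 , next∈ c≢1 , nbhd⁺ 1 0 (next refl) , ∉nbhd 2 0 1 1 (tt , tt , tt , tt)

    separate : ∀ y → x ≢ y → ∃ (Separates x y)
    separate y x≢y with c ≟ 2
    ... | yes c≡2 = subst (λ u → ∃ (Separates u y)) centre≡x
                      (separate-uncoded (λ c≡0 → case trans (sym c≡0) c≡2 of λ ())
                                        (λ c≡1 → case trans (sym c≡1) c≡2 of λ ())
                                        y (x≢y ∘ trans (sym centre≡x)))
    ... | no  c≢2 = subst (λ u → ∃ (Separates u y)) centre≡x (separate-coded c≢2 y (x≢y ∘ trans (sym centre≡x)))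

  C₀-self-identifying : SelfIdentifying G C₀
  C₀-self-identifying = (⟦ 0 ⟧ , ⟦⟧∈C₀ 0 colour-0≢2) , Separation.separate
    where
    colour-0≢2 : colour 0 ≢ 2
    colour-0≢2 c≡2 = case trans (sym (cong (_% 3) (m*n%n≡0 0 k))) c≡2 of λ ()

  γSID-value : ∀ m → m + 2 * (k / 3) ≡ 2 * k → γSID≡ G m
  γSID-value m m+2q≡2k =
    (C₀ , C₀-self-identifying , +-cancelʳ-≡ (2 * (k / 3)) ∣ C₀ ∣ m (trans ∣C₀∣+2⌊k/3⌋≡2k (sym m+2q≡2k))) ,
    λ C sid → +-cancelʳ-≤ (2 * (k / 3)) m ∣ C ∣ (≤-trans (≤-reflexive m+2q≡2k) (LowerBound.2k≤∣C∣+2⌊k/3⌋ sid))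

γ-formula : ∀ k → (4 * k + 2) / 3 + 2 * (k / 3) + 2 * (k % 3) ≡ 2 * k + (4 * (k % 3) + 2) / 3
γ-formula k = begin
  (4 * k + 2) / 3 + 2 * q + 2 * r                    ≡⟨ cong (λ m → m + 2 * q + 2 * r) four-thirds ⟩
  (4 * r + 2) / 3 + q * 4 + 2 * q + 2 * r            ≡⟨ regroup ((4 * r + 2) / 3) q r ⟩
  2 * (r + q * 3) + (4 * r + 2) / 3                  ≡⟨ cong (λ m → 2 * m + (4 * r + 2) / 3) k≡ ⟨
  2 * k + (4 * r + 2) / 3                            ∎
  where
  open ≡-Reasoning
  q r : ℕ
  q = k / 3
  r = k % 3
  k≡ : k ≡ r + q * 3
  k≡ = m≡m%n+[m/n]*n k 3
  four-thirds : (4 * k + 2) / 3 ≡ (4 * r + 2) / 3 + q * 4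
  four-thirds = begin
    (4 * k + 2) / 3                     ≡⟨ cong (λ m → (4 * m + 2) / 3) k≡ ⟩
    (4 * (r + q * 3) + 2) / 3           ≡⟨ cong (_/ 3) (split r q) ⟩
    (4 * r + 2 + q * 4 * 3) / 3         ≡⟨ +-distrib-/-∣ʳ (4 * r + 2) (divides (q * 4) refl) ⟩
    (4 * r + 2) / 3 + q * 4 * 3 / 3     ≡⟨ cong ((4 * r + 2) / 3 +_) (m*n/n≡m (q * 4) 3) ⟩
    (4 * r + 2) / 3 + q * 4             ∎
    where
    split : ∀ r q → 4 * (r + q * 3) + 2 ≡ 4 * r + 2 + q * 4 * 3
    split = solve-∀
  regroup : ∀ x q r → x + q * 4 + 2 * q + 2 * r ≡ 2 * (r + q * 3) + x
  regroup = solve-∀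

theorem10 : (k : ℕ) → 5 ≤ k →
    ((k % 3 ≡ 0) → γSID≡ (Circulant1k k) ((4 * k + 2) / 3)) ×
    ((k % 3 ≡ 1) → γSID≡ (Circulant1k k) ((4 * k + 2) / 3)) ×
    ((k % 3 ≡ 2) → γSID≡ (Circulant1k k) ((4 * k + 2) / 3 + 1))
theorem10 k 5≤k = residue-0 , residue-1 , residue-2
  where
  open Ladder k 5≤k using (γSID-value)
  formula : ∀ {r} → k % 3 ≡ r → (4 * k + 2) / 3 + 2 * (k / 3) + 2 * r ≡ 2 * k + (4 * r + 2) / 3
  formula refl = γ-formula k
  residue-0 : k % 3 ≡ 0 → γSID≡ (Circulant1k k) ((4 * k + 2) / 3)
  residue-0 r≡0 = γSID-value _ (+-cancelʳ-≡ 0 _ _ (formula r≡0))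
  residue-1 : k % 3 ≡ 1 → γSID≡ (Circulant1k k) ((4 * k + 2) / 3)
  residue-1 r≡1 = γSID-value _ (+-cancelʳ-≡ 2 _ _ (formula r≡1))
  residue-2 : k % 3 ≡ 2 → γSID≡ (Circulant1k k) ((4 * k + 2) / 3 + 1)
  residue-2 r≡2 = γSID-value _ (+-cancelʳ-≡ 3 _ _ (trans (shuffle ((4 * k + 2) / 3) (2 * (k / 3))) (formula r≡2)))
    where
    shuffle : ∀ x y → x + 1 + y + 3 ≡ x + y + 4
    shuffle = solve-∀
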